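{- Let $(V,\mathcal{B})$ be a $(t+1)$-$(v,k,\lambda)$ adesign with $b$ blocks. For a $t$-subset $Y\subseteq V$, let $r_Y$ denote the number of blocks of $\mathcal{B}$ containing $Y$. Then for every $t$-subset $Y$ of $V$, \[\lambda\le r_Y\frac{k-t}{v-t}\le \lambda+1.\] If $\frac{k-t}{v-t}>\frac12$, then $(V,\mathcal{B})$ is either a $t$-$(v,k,\lambda')$ adesign with $\lambda'=\lceil\lambda\frac{v-t}{k-t}\rceil$, or a $t$-$(v,k,\lambda')$ design with $\lambda'=\lceil\lambda\frac{v-t}{k-t}\rceil$ or $\lambda'=\lceil\lambda\frac{v-t}{k-t}\rceil+1$. Moreover, if $(V,\mathcal{B})$ is a $t$-$(v,k,\lambda')$ design, then $\lambda=\lfloor\lambda'\frac{k-t}{v-t}\rfloor$ and \[\lambda\binom{v}{t+1}\Big/\binom{k}{t+1}<b<(\lambda+1)\binom{v}{t+1}\Big/\binom{k}{t+1}.\]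
   Context: An incidence structure $(V,\mathcal{B})$ consists of a finite point set $V$ and a collection $\mathcal{B}$ of subsets (blocks) of $V$, incidence being membership; incidence structures are assumed simple (no repeated blocks). A $t$-$(v,k,\lambda)$ design ($0<t<k<v$) is an incidence structure with $|V|=v$, all blocks of size $k$, and every $t$-subset of $V$ contained in exactly $\lambda$ blocks. A $t$-$(v,k,\lambda)$ adesign is an incidence structure with $|V|=v$, all blocks of size $k$, such that for a positive integer $\lambda$ every $t$-subset of $V$ is contained in either $\lambda$ or $\lambda+1$ blocks, and which is not a $t$-design. -}

module Defs where

open import Data.Nat using (ℕ; zero; suc; _+_; _*_; _<_; _/_)
open import Data.List using (List; length; filter)
open import Data.List.Relation.Unary.All using (All)
open import Data.Fin.Subset using (Subset; ∣_∣)
open import Data.Fin.Subset.Properties using (_⊆?_)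
open import Data.Product using (_×_; ∃)
open import Data.Sum using (_⊎_)
open import Relation.Binary.PropositionalEquality using (_≡_)
open import Relation.Nullary using (¬_)

-- An incidence structure on the point set V = Fin v is a list of blocks
-- (subsets of Fin v); simplicity (no repeated blocks) is imposed separately
-- via `Unique`.

r : ∀ {v} → List (Subset v) → Subset v → ℕ
r B Y = length (filter (Y ⊆?_) B)

Uniform : ∀ {v} → ℕ → List (Subset v) → Set
Uniform k B = All (λ X → ∣ X ∣ ≡ k) B

IsDesign : (t v k l : ℕ) → List (Subset v) → Set
IsDesign t v k l B =
  0 < t × t < k × k < v × Uniform k B ×
  (∀ (Y : Subset v) → ∣ Y ∣ ≡ t → r B Y ≡ l)

IsADesign : (t v k l : ℕ) → List (Subset v) → Set
IsADesign t v k l B =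
  0 < t × t < k × k < v × 0 < l × Uniform k B ×
  (∀ (Y : Subset v) → ∣ Y ∣ ≡ t → r B Y ≡ l ⊎ r B Y ≡ suc l) ×
  ¬ (∃ (λ μ → IsDesign t v k μ B))

-- ⌈ a / b ⌉ and ⌊ a / b ⌋ (value at b = 0 irrelevant, set to 0)
ceilDiv : ℕ → ℕ → ℕ
ceilDiv a zero = 0
ceilDiv a (suc b) = (a + b) / suc b

floorDiv : ℕ → ℕ → ℕ
floorDiv a zero = 0
floorDiv a (suc b) = a / suc b

-- Fix a t-subset Y.  Counting the pairs (Z, b) with Y ⊂ Z ⊆ b, ∣ Z ∣ = t + 1
-- and b a block gives  Σ_Z r_Z = r_Y (k − t),  the sum running over the v − t
-- one-point extensions Z of Y.  As every r_Z is λ or λ + 1, r_Y (k − t) lies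
-- between λ (v − t) and (λ + 1)(v − t); when 2 (k − t) > v − t this leaves room
-- for only two consecutive values of r_Y.  Either bound is attained only if all
-- r_Z are equal, i.e. if B is a (t + 1)-design, which an adesign is not; for a
-- t-design this strictness pins λ down as ⌊λ′ (k − t) / (v − t)⌋.  The same
-- double count over all (t + 1)-subsets, Σ_Z r_Z = b C(k, t + 1), gives the
-- bounds on b.
module Submission where

open import Defs
open import Data.Nat
open import Data.Nat.Properties
open import Data.Nat.DivMod using (m≡m%n+[m/n]*n; m%n<n; m/n*n≤m; m*n/n≡m; /-monoˡ-≤; m<n*o⇒m/o<n)
open import Data.Nat.Combinatorics using (_C_; nCk+nC[k+1]≡[n+1]C[k+1])
open import Algebra.Properties.CommutativeSemigroup +-commutativeSemigroup using (interchange; x∙yz≈y∙xz)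
open import Data.Bool using (true; false; if_then_else_)
open import Data.List using (List; []; _∷_; length; map; _++_)
open import Data.Vec using ([]; _∷_)
open import Data.List.Properties using (length-map; length-++)
open import Data.List.Relation.Unary.All as All using (All; []; _∷_)
import Data.List.Relation.Unary.All.Properties as AllP
open import Data.List.Relation.Unary.Any using (here; there)
open import Data.List.Membership.Propositional using (_∈_)
open import Data.List.Membership.Propositional.Properties using (∈-map⁺; ∈-++⁺ˡ; ∈-++⁺ʳ)
open import Data.List.Relation.Unary.Unique.Propositional using (Unique)
open import Data.Fin.Subset using (Subset; ∣_∣; ⊥)
open import Data.Fin.Subset.Properties using (_⊆?_; anySubset?; ∣p∣≤n; ∣⊥∣≡0)
open import Data.Product using (_×_; _,_; ∃; proj₁; proj₂)
open import Data.Sum using (_⊎_; inj₁; inj₂)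
open import Function using (_∘_)
open import Relation.Binary.PropositionalEquality
open import Relation.Nullary using (¬_; does; yes; no)
open import Relation.Nullary.Decidable using (_×-dec_; ¬?; decidable-stable)

private variable
  A A′ : Set
  f g : A → ℕ
  L : List A
  a d l m t v k : ℕ

∑ : List A → (A → ℕ) → ℕ
∑ []       f = 0
∑ (x ∷ xs) f = f x + ∑ xs f

syntax ∑ L (λ x → e) = ∑[ x ∈ L ] e

∑-cong : All (λ x → f x ≡ g x) L → ∑ L f ≡ ∑ L g
∑-cong []       = refl
∑-cong (e ∷ es) = cong₂ _+_ e (∑-cong es)

∑-const : ∀ c (L : List A) → ∑[ _ ∈ L ] c ≡ c * length L
∑-const c []      = sym (*-zeroʳ c)
∑-const c (_ ∷ L) = trans (cong (c +_) (∑-const c L)) (sym (*-suc c (length L)))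

∑-map : ∀ (h : A′ → A) (L : List A′) → ∑ (map h L) f ≡ ∑ L (f ∘ h)
∑-map         h []      = refl
∑-map {f = f} h (x ∷ L) = cong (f (h x) +_) (∑-map h L)

∑-++ : ∀ (L M : List A) → ∑ (L ++ M) f ≡ ∑ L f + ∑ M f
∑-++         []      M = refl
∑-++ {f = f} (x ∷ L) M = trans (cong (f x +_) (∑-++ L M)) (sym (+-assoc (f x) _ _))

∑-+ : ∀ (L : List A) → ∑[ x ∈ L ] (f x + g x) ≡ ∑ L f + ∑ L g
∑-+                 []      = refl
∑-+ {f = f} {g = g} (x ∷ L) =
  trans (cong (f x + g x +_) (∑-+ L)) (interchange (f x) (g x) (∑ L f) (∑ L g))

∑-*ʳ : ∀ c (L : List A) → ∑[ x ∈ L ] (f x * c) ≡ ∑ L f * c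
∑-*ʳ         c []      = refl
∑-*ʳ {f = f} c (x ∷ L) = trans (cong (f x * c +_) (∑-*ʳ c L)) (sym (*-distribʳ-+ c (f x) (∑ L f)))

∑-comm : ∀ (h : A → A′ → ℕ) (L : List A) (M : List A′) →
  ∑[ x ∈ L ] ∑[ y ∈ M ] h x y ≡ ∑[ y ∈ M ] ∑[ x ∈ L ] h x y
∑-comm h []      M = sym (∑-const 0 M)
∑-comm h (x ∷ L) M = trans (cong (∑ M (h x) +_) (∑-comm h L M)) (sym (∑-+ M))

∑-mono-≤ : All (λ x → f x ≤ g x) L → ∑ L f ≤ ∑ L g
∑-mono-≤ []       = z≤n
∑-mono-≤ (p ∷ ps) = +-mono-≤ p (∑-mono-≤ ps)

∑-mono-≤-≡ : All (λ x → f x ≤ g x) L → ∑ L f ≡ ∑ L g → All (λ x → f x ≡ g x) L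
∑-mono-≤-≡                           []       _  = []
∑-mono-≤-≡ {f = f} {g = g} {L = x ∷ L} (p ∷ ps) eq =
  fx≡gx ∷ ∑-mono-≤-≡ ps (+-cancelˡ-≡ (f x) _ _ (trans eq (cong (_+ ∑ L g) (sym fx≡gx))))
  where
  fx≡gx : f x ≡ g x
  fx≡gx = ≤-antisym p (+-cancelʳ-≤ (∑ L g) (g x) (f x)
    (≤-trans (≤-reflexive (sym eq)) (+-monoʳ-≤ (f x) (∑-mono-≤ ps))))

∑-bounds : ∀ l u → All (λ x → l ≤ f x × f x ≤ u) L → l * length L ≤ ∑ L f × ∑ L f ≤ u * length L
∑-bounds {L = L} l u bounded =
    subst (_≤ _) (∑-const l L) (∑-mono-≤ (All.map proj₁ bounded))
  , subst (_ ≤_) (∑-const u L) (∑-mono-≤ (All.map proj₂ bounded))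

∑≡lower⇒all≡ : ∀ l → All (λ x → l ≤ f x) L → ∑ L f ≡ l * length L → All (λ x → f x ≡ l) L
∑≡lower⇒all≡ {L = L} l l≤f eq = All.map sym (∑-mono-≤-≡ l≤f (trans (∑-const l L) (sym eq)))

∑≡upper⇒all≡ : ∀ u → All (λ x → f x ≤ u) L → ∑ L f ≡ u * length L → All (λ x → f x ≡ u) L
∑≡upper⇒all≡ {L = L} u f≤u eq = ∑-mono-≤-≡ f≤u (trans eq (sym (∑-const u L)))

∑-strict-bounds : ∀ l u → All (λ x → l ≤ f x × f x ≤ u) L →
  ¬ All (λ x → f x ≡ l) L → ¬ All (λ x → f x ≡ u) L →
  l * length L < ∑ L f × ∑ L f < u * length L
∑-strict-bounds l u bounded ¬all≡l ¬all≡u =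
    ≤∧≢⇒< (proj₁ (∑-bounds l u bounded)) (¬all≡l ∘ ∑≡lower⇒all≡ l (All.map proj₁ bounded) ∘ sym)
  , ≤∧≢⇒< (proj₂ (∑-bounds l u bounded)) (¬all≡u ∘ ∑≡upper⇒all≡ u (All.map proj₂ bounded))

≡⊎≡suc⇒≤×≤ : m ≡ l ⊎ m ≡ suc l → l ≤ m × m ≤ suc l
≡⊎≡suc⇒≤×≤ (inj₁ refl) = ≤-refl , n≤1+n _
≡⊎≡suc⇒≤×≤ (inj₂ refl) = n≤1+n _ , ≤-refl

ceilDiv-spec : ∀ a → 0 < d → a ≤ ceilDiv a d * d × ceilDiv a d * d < a + d
ceilDiv-spec {suc e} a _ = lower , upper
  where
  c : ℕ
  c = (a + e) / suc e
  upper : c * suc e < a + suc e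
  upper = ≤-trans (s≤s (m/n*n≤m (a + e) (suc e))) (≤-reflexive (sym (+-suc a e)))
  lower : a ≤ c * suc e
  lower = +-cancelʳ-≤ e a (c * suc e) (s≤s⁻¹ (begin-strict
    a + e                        ≡⟨ m≡m%n+[m/n]*n (a + e) (suc e) ⟩
    (a + e) % suc e + c * suc e  <⟨ +-monoˡ-< (c * suc e) (m%n<n (a + e) (suc e)) ⟩
    suc e + c * suc e            ≡⟨ cong suc (+-comm e (c * suc e)) ⟩
    suc (c * suc e + e)          ∎))
    where open ≤-Reasoning

ceilDiv-pos : 0 < d → 0 < a → 0 < ceilDiv a d
ceilDiv-pos {d} {a} 0<d 0<a = *-cancelʳ-< d 0 _ (<-≤-trans 0<a (proj₁ (ceilDiv-spec a 0<d)))

ceilDiv-or-suc : ∀ {w} q → 0 < d → a ≤ q * d → q * d ≤ w + a → w < 2 * d →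
  q ≡ ceilDiv a d ⊎ q ≡ suc (ceilDiv a d)
ceilDiv-or-suc {d} {a} {w} q 0<d a≤qd qd≤w+a w<2d = by-cases (m≤n⇒m<n∨m≡n c≤q)
  where
  c : ℕ
  c = ceilDiv a d
  c≤q : c ≤ q
  c≤q = s≤s⁻¹ (*-cancelʳ-< d c (suc q) (begin-strict
    c * d      <⟨ proj₂ (ceilDiv-spec a 0<d) ⟩
    a + d      ≤⟨ +-monoˡ-≤ d a≤qd ⟩
    q * d + d  ≡⟨ +-comm (q * d) d ⟩
    suc q * d  ∎))
    where open ≤-Reasoning
  q<2+c : q < suc (suc c)
  q<2+c = *-cancelʳ-< d q (suc (suc c)) (begin-strict
    q * d          ≤⟨ qd≤w+a ⟩
    w + a          <⟨ +-monoˡ-< a w<2d ⟩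
    2 * d + a      ≤⟨ +-monoʳ-≤ (2 * d) (proj₁ (ceilDiv-spec a 0<d)) ⟩
    2 * d + c * d  ≡⟨ *-distribʳ-+ d 2 c ⟨
    suc (suc c) * d ∎)
    where open ≤-Reasoning
  by-cases : c < q ⊎ c ≡ q → q ≡ c ⊎ q ≡ suc c
  by-cases (inj₁ c<q) = inj₂ (≤-antisym (s≤s⁻¹ q<2+c) c<q)
  by-cases (inj₂ c≡q) = inj₁ (sym c≡q)

floorDiv-unique : ∀ q → 0 < d → q * d ≤ a → a < suc q * d → floorDiv a d ≡ q
floorDiv-unique {suc e} {a} q _ qd≤a a<[1+q]d = ≤-antisym
  (s≤s⁻¹ (m<n*o⇒m/o<n a<[1+q]d))
  (subst (_≤ a / suc e) (m*n/n≡m q (suc e)) (/-monoˡ-≤ (suc e) qd≤a))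

⟦_⊆_⟧ : Subset v → Subset v → ℕ
⟦ Y ⊆ b ⟧ = if does (Y ⊆? b) then 1 else 0

r-as-∑ : ∀ (B : List (Subset v)) Y → r B Y ≡ ∑[ b ∈ B ] ⟦ Y ⊆ b ⟧
r-as-∑ []      Y = refl
r-as-∑ (b ∷ B) Y with does (Y ⊆? b)
... | true  = cong suc (r-as-∑ B Y)
... | false = r-as-∑ B Y

∑-r-by-blocks : ∀ (B L : List (Subset v)) → ∑[ Z ∈ L ] r B Z ≡ ∑[ b ∈ B ] ∑[ Z ∈ L ] ⟦ Z ⊆ b ⟧
∑-r-by-blocks B L = trans (∑-cong (All.universal (r-as-∑ B) L)) (∑-comm ⟦_⊆_⟧ L B)

extensions : Subset v → List (Subset v)
extensions []          = []
extensions (true ∷ Y)  = map (true ∷_) (extensions Y)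
extensions (false ∷ Y) = (true ∷ Y) ∷ map (false ∷_) (extensions Y)

length-extensions : (Y : Subset v) → length (extensions Y) ≡ v ∸ ∣ Y ∣
length-extensions []          = refl
length-extensions (true ∷ Y)  = trans (length-map (true ∷_) (extensions Y)) (length-extensions Y)
length-extensions (false ∷ Y) =
  trans (cong suc (trans (length-map (false ∷_) (extensions Y)) (length-extensions Y)))
        (sym (+-∸-assoc 1 (∣p∣≤n Y)))

∣extensions∣ : (Y : Subset v) → All (λ Z → ∣ Z ∣ ≡ suc ∣ Y ∣) (extensions Y)
∣extensions∣ []          = []
∣extensions∣ (true ∷ Y)  = AllP.map⁺ (All.map (cong suc) (∣extensions∣ Y))
∣extensions∣ (false ∷ Y) = refl ∷ AllP.map⁺ (∣extensions∣ Y)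

∈-extensions : ∀ t (Z : Subset v) → ∣ Z ∣ ≡ suc t → ∃ λ Y → ∣ Y ∣ ≡ t × Z ∈ extensions Y
∈-extensions t (true ∷ Z)  e = false ∷ Z , suc-injective e , here refl
∈-extensions t (false ∷ Z) e with ∈-extensions t Z e
... | Y , ∣Y∣≡t , Z∈ = false ∷ Y , ∣Y∣≡t , there (∈-map⁺ (false ∷_) Z∈)

∑-extensions-⊆ : ∀ (Y b : Subset v) →
  ∑[ Z ∈ extensions Y ] ⟦ Z ⊆ b ⟧ + ⟦ Y ⊆ b ⟧ * ∣ Y ∣ ≡ ⟦ Y ⊆ b ⟧ * ∣ b ∣
∑-extensions-⊆ [] [] = refl
∑-extensions-⊆ (true ∷ Y) (true ∷ b) = begin
  ∑ (map (true ∷_) (extensions Y)) ⟦_⊆ true ∷ b ⟧ + ⟦ Y ⊆ b ⟧ * suc ∣ Y ∣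
    ≡⟨ cong₂ _+_ (∑-map (true ∷_) (extensions Y)) (*-suc ⟦ Y ⊆ b ⟧ ∣ Y ∣) ⟩
  ∑[ Z ∈ extensions Y ] ⟦ Z ⊆ b ⟧ + (⟦ Y ⊆ b ⟧ + ⟦ Y ⊆ b ⟧ * ∣ Y ∣)
    ≡⟨ x∙yz≈y∙xz (∑[ Z ∈ extensions Y ] ⟦ Z ⊆ b ⟧) ⟦ Y ⊆ b ⟧ (⟦ Y ⊆ b ⟧ * ∣ Y ∣) ⟩
  ⟦ Y ⊆ b ⟧ + (∑[ Z ∈ extensions Y ] ⟦ Z ⊆ b ⟧ + ⟦ Y ⊆ b ⟧ * ∣ Y ∣)
    ≡⟨ cong (⟦ Y ⊆ b ⟧ +_) (∑-extensions-⊆ Y b) ⟩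
  ⟦ Y ⊆ b ⟧ + ⟦ Y ⊆ b ⟧ * ∣ b ∣
    ≡⟨ *-suc ⟦ Y ⊆ b ⟧ ∣ b ∣ ⟨
  ⟦ Y ⊆ b ⟧ * suc ∣ b ∣ ∎
  where open ≡-Reasoning
∑-extensions-⊆ (true ∷ Y) (false ∷ b) =
  trans (+-identityʳ _) (trans (∑-map (true ∷_) (extensions Y)) (∑-const 0 (extensions Y)))
∑-extensions-⊆ (false ∷ Y) (true ∷ b) =
  trans (cong (λ s → ⟦ Y ⊆ b ⟧ + s + ⟦ Y ⊆ b ⟧ * ∣ Y ∣) (∑-map (false ∷_) (extensions Y)))
  (trans (+-assoc ⟦ Y ⊆ b ⟧ _ _)
  (trans (cong (⟦ Y ⊆ b ⟧ +_) (∑-extensions-⊆ Y b)) (sym (*-suc ⟦ Y ⊆ b ⟧ ∣ b ∣))))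
∑-extensions-⊆ (false ∷ Y) (false ∷ b) =
  trans (cong (_+ ⟦ Y ⊆ b ⟧ * ∣ Y ∣) (∑-map (false ∷_) (extensions Y))) (∑-extensions-⊆ Y b)

subsets : ∀ v → ℕ → List (Subset v)
subsets zero    zero    = [] ∷ []
subsets zero    (suc t) = []
subsets (suc v) zero    = map (false ∷_) (subsets v zero)
subsets (suc v) (suc t) = map (true ∷_) (subsets v t) ++ map (false ∷_) (subsets v (suc t))

∣subsets∣ : ∀ v t → All (λ Y → ∣ Y ∣ ≡ t) (subsets v t)
∣subsets∣ zero    zero    = refl ∷ []
∣subsets∣ zero    (suc t) = []
∣subsets∣ (suc v) zero    = AllP.map⁺ (∣subsets∣ v zero)
∣subsets∣ (suc v) (suc t) =
  AllP.++⁺ (AllP.map⁺ (All.map (cong suc) (∣subsets∣ v t))) (AllP.map⁺ (∣subsets∣ v (suc t)))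

∈-subsets : ∀ (Y : Subset v) → ∣ Y ∣ ≡ t → Y ∈ subsets v t
∈-subsets {t = zero}  []          _ = here refl
∈-subsets {t = suc t} (true ∷ Y)  e = ∈-++⁺ˡ (∈-map⁺ (true ∷_) (∈-subsets Y (suc-injective e)))
∈-subsets {t = zero}  (false ∷ Y) e = ∈-map⁺ (false ∷_) (∈-subsets Y e)
∈-subsets {t = suc t} (false ∷ Y) e = ∈-++⁺ʳ _ (∈-map⁺ (false ∷_) (∈-subsets Y e))

length-subsets : ∀ v t → length (subsets v t) ≡ v C t
length-subsets zero    zero    = refl
length-subsets zero    (suc t) = refl
length-subsets (suc v) zero    = trans (length-map (false ∷_) (subsets v zero)) (length-subsets v zero)
length-subsets (suc v) (suc t) = begin
  length (map (true ∷_) (subsets v t) ++ map (false ∷_) (subsets v (suc t)))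
    ≡⟨ length-++ (map (true ∷_) (subsets v t)) ⟩
  length (map (true ∷_) (subsets v t)) + length (map (false ∷_) (subsets v (suc t)))
    ≡⟨ cong₂ _+_ (length-map (true ∷_) (subsets v t)) (length-map (false ∷_) (subsets v (suc t))) ⟩
  length (subsets v t) + length (subsets v (suc t))
    ≡⟨ cong₂ _+_ (length-subsets v t) (length-subsets v (suc t)) ⟩
  v C t + v C suc t
    ≡⟨ nCk+nC[k+1]≡[n+1]C[k+1] v t ⟩
  suc v C suc t ∎
  where open ≡-Reasoning

∑-subsets-⊆ : ∀ t (b : Subset v) → ∑[ Y ∈ subsets v t ] ⟦ Y ⊆ b ⟧ ≡ ∣ b ∣ C t
∑-subsets-⊆         zero    []          = refl
∑-subsets-⊆         (suc t) []          = refl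
∑-subsets-⊆ {suc v} zero    (_ ∷ b)     = trans (∑-map (false ∷_) (subsets v zero)) (∑-subsets-⊆ zero b)
∑-subsets-⊆ {suc v} (suc t) (true ∷ b)  = begin
  ∑ (map (true ∷_) (subsets v t) ++ map (false ∷_) (subsets v (suc t))) ⟦_⊆ true ∷ b ⟧
    ≡⟨ ∑-++ (map (true ∷_) (subsets v t)) _ ⟩
  ∑ (map (true ∷_) (subsets v t)) ⟦_⊆ true ∷ b ⟧ + ∑ (map (false ∷_) (subsets v (suc t))) ⟦_⊆ true ∷ b ⟧
    ≡⟨ cong₂ _+_ (∑-map (true ∷_) (subsets v t)) (∑-map (false ∷_) (subsets v (suc t))) ⟩
  ∑[ Y ∈ subsets v t ] ⟦ Y ⊆ b ⟧ + ∑[ Y ∈ subsets v (suc t) ] ⟦ Y ⊆ b ⟧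
    ≡⟨ cong₂ _+_ (∑-subsets-⊆ t b) (∑-subsets-⊆ (suc t) b) ⟩
  ∣ b ∣ C t + ∣ b ∣ C suc t
    ≡⟨ nCk+nC[k+1]≡[n+1]C[k+1] ∣ b ∣ t ⟩
  suc ∣ b ∣ C suc t ∎
  where open ≡-Reasoning
∑-subsets-⊆ {suc v} (suc t) (false ∷ b) = begin
  ∑ (map (true ∷_) (subsets v t) ++ map (false ∷_) (subsets v (suc t))) ⟦_⊆ false ∷ b ⟧
    ≡⟨ ∑-++ (map (true ∷_) (subsets v t)) _ ⟩
  ∑ (map (true ∷_) (subsets v t)) ⟦_⊆ false ∷ b ⟧ + ∑ (map (false ∷_) (subsets v (suc t))) ⟦_⊆ false ∷ b ⟧
    ≡⟨ cong₂ _+_ (trans (∑-map (true ∷_) (subsets v t)) (∑-const 0 (subsets v t)))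
                 (∑-map (false ∷_) (subsets v (suc t))) ⟩
  ∑[ Y ∈ subsets v (suc t) ] ⟦ Y ⊆ b ⟧
    ≡⟨ ∑-subsets-⊆ (suc t) b ⟩
  ∣ b ∣ C suc t ∎
  where open ≡-Reasoning

subset-of-size : t ≤ v → ∃ λ (Y : Subset v) → ∣ Y ∣ ≡ t
subset-of-size {zero}  {v}     _         = ⊥ , ∣⊥∣≡0 v
subset-of-size {suc t} {suc v} (s≤s t≤v) with subset-of-size t≤v
... | Y , ∣Y∣≡t = true ∷ Y , cong suc ∣Y∣≡t

∑-extensions-r : {B : List (Subset v)} → Uniform k B → (Y : Subset v) → ∑[ Z ∈ extensions Y ] r B Z ≡ r B Y * (k ∸ ∣ Y ∣)
∑-extensions-r {k = k} {B = B} uniform Y = begin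
  ∑[ Z ∈ extensions Y ] r B Z
    ≡⟨ m+n∸n≡m _ (r B Y * ∣ Y ∣) ⟨
  ∑[ Z ∈ extensions Y ] r B Z + r B Y * ∣ Y ∣ ∸ r B Y * ∣ Y ∣
    ≡⟨ cong (_∸ r B Y * ∣ Y ∣) double-count ⟩
  r B Y * k ∸ r B Y * ∣ Y ∣
    ≡⟨ *-distribˡ-∸ (r B Y) k ∣ Y ∣ ⟨
  r B Y * (k ∸ ∣ Y ∣) ∎
  where
  open ≡-Reasoning
  double-count : ∑[ Z ∈ extensions Y ] r B Z + r B Y * ∣ Y ∣ ≡ r B Y * k
  double-count = begin
    ∑[ Z ∈ extensions Y ] r B Z + r B Y * ∣ Y ∣
      ≡⟨ cong₂ _+_ (∑-r-by-blocks B (extensions Y)) (trans (cong (_* ∣ Y ∣) (r-as-∑ B Y)) (sym (∑-*ʳ ∣ Y ∣ B))) ⟩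
    ∑[ b ∈ B ] ∑[ Z ∈ extensions Y ] ⟦ Z ⊆ b ⟧ + ∑[ b ∈ B ] (⟦ Y ⊆ b ⟧ * ∣ Y ∣)
      ≡⟨ ∑-+ B ⟨
    ∑[ b ∈ B ] (∑[ Z ∈ extensions Y ] ⟦ Z ⊆ b ⟧ + ⟦ Y ⊆ b ⟧ * ∣ Y ∣)
      ≡⟨ ∑-cong (All.map (λ {b} ∣b∣≡k → trans (∑-extensions-⊆ Y b) (cong (⟦ Y ⊆ b ⟧ *_) ∣b∣≡k)) uniform) ⟩
    ∑[ b ∈ B ] (⟦ Y ⊆ b ⟧ * k)
      ≡⟨ ∑-*ʳ k B ⟩
    ∑[ b ∈ B ] ⟦ Y ⊆ b ⟧ * k
      ≡⟨ cong (_* k) (r-as-∑ B Y) ⟨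
    r B Y * k ∎

∑-subsets-r : {B : List (Subset v)} → Uniform k B → ∀ s → ∑[ Y ∈ subsets v s ] r B Y ≡ length B * (k C s)
∑-subsets-r {v = v} {k = k} {B = B} uniform s = begin
  ∑[ Y ∈ subsets v s ] r B Y
    ≡⟨ ∑-r-by-blocks B (subsets v s) ⟩
  ∑[ b ∈ B ] ∑[ Y ∈ subsets v s ] ⟦ Y ⊆ b ⟧
    ≡⟨ ∑-cong (All.map (λ {b} ∣b∣≡k → trans (∑-subsets-⊆ s b) (cong (_C s) ∣b∣≡k)) uniform) ⟩
  ∑[ _ ∈ B ] (k C s)
    ≡⟨ ∑-const (k C s) B ⟩
  (k C s) * length B
    ≡⟨ *-comm (k C s) (length B) ⟩
  length B * (k C s) ∎
  where open ≡-Reasoning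

Regular : ℕ → ℕ → List (Subset v) → Set
Regular s μ B = ∀ Y → ∣ Y ∣ ≡ s → r B Y ≡ μ

AlmostRegular : ℕ → ℕ → List (Subset v) → Set
AlmostRegular s l B = ∀ Z → ∣ Z ∣ ≡ s → r B Z ≡ l ⊎ r B Z ≡ suc l

regular-or-counterexample : ∀ s μ (B : List (Subset v)) → Regular s μ B ⊎ ∃ λ Y → ∣ Y ∣ ≡ s × r B Y ≢ μ
regular-or-counterexample s μ B with anySubset? (λ Y → (∣ Y ∣ ≟ s) ×-dec ¬? (r B Y ≟ μ))
... | yes (Y , ∣Y∣≡s , r≢μ) = inj₂ (Y , ∣Y∣≡s , r≢μ)
... | no ¬counterexample    =
  inj₁ λ Y ∣Y∣≡s → decidable-stable (r B Y ≟ μ) (λ r≢μ → ¬counterexample (Y , ∣Y∣≡s , r≢μ))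

extension-bounds : {B : List (Subset v)} → Uniform k B → AlmostRegular (suc t) l B → (Y : Subset v) → ∣ Y ∣ ≡ t →
  l * (v ∸ t) ≤ r B Y * (k ∸ t) × r B Y * (k ∸ t) ≤ suc l * (v ∸ t)
extension-bounds {l = l} uniform almost Y refl
  with ∑-bounds l (suc l) (All.map (λ {Z} → ≡⊎≡suc⇒≤×≤ ∘ almost Z) (∣extensions∣ Y))
... | lower , upper =
    subst₂ _≤_ (cong (l *_) (length-extensions Y)) (∑-extensions-r uniform Y) lower
  , subst₂ _≤_ (∑-extensions-r uniform Y) (cong (suc l *_) (length-extensions Y)) upper

-- Each sum Σ_{Z ⊃ Y} r_Z attains its maximum m (v − t), so every summand equals m.
upper-bound-attained⇒regular : {B : List (Subset v)} → Uniform k B → (∀ Z → ∣ Z ∣ ≡ suc t → r B Z ≤ m) →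
  (∀ Y → ∣ Y ∣ ≡ t → r B Y * (k ∸ t) ≡ m * (v ∸ t)) → Regular (suc t) m B
upper-bound-attained⇒regular {m = m} {B = B} uniform r≤m attained Z ∣Z∣≡1+t
  with ∈-extensions _ Z ∣Z∣≡1+t
... | Y , refl , Z∈ = All.lookup (∑≡upper⇒all≡ m (All.map (λ {Z′} → r≤m Z′) (∣extensions∣ Y)) sum≡) Z∈
  where
  sum≡ : ∑[ Z′ ∈ extensions Y ] r B Z′ ≡ m * length (extensions Y)
  sum≡ = trans (∑-extensions-r uniform Y)
               (trans (attained Y refl) (cong (m *_) (sym (length-extensions Y))))

adesign-block-bounds : ∀ {s v k l} {B : List (Subset v)} → IsADesign s v k l B →
  l * (v C s) < length B * (k C s) × length B * (k C s) < suc l * (v C s)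
adesign-block-bounds {s} {v} {k} {l} {B} (0<s , s<k , k<v , _ , uniform , almost , ¬design) =
    subst₂ _<_ (cong (l *_) (length-subsets v s)) (∑-subsets-r uniform s) (proj₁ bounds)
  , subst₂ _<_ (∑-subsets-r uniform s) (cong (suc l *_) (length-subsets v s)) (proj₂ bounds)
  where
  ¬regular : ∀ μ → ¬ All (λ Y → r B Y ≡ μ) (subsets v s)
  ¬regular μ all = ¬design (μ , 0<s , s<k , k<v , uniform , λ Y e → All.lookup all (∈-subsets Y e))
  bounds : l * length (subsets v s) < ∑[ Y ∈ subsets v s ] r B Y
         × ∑[ Y ∈ subsets v s ] r B Y < suc l * length (subsets v s)
  bounds = ∑-strict-bounds l (suc l) (All.map (λ {Z} → ≡⊎≡suc⇒≤×≤ ∘ almost Z) (∣subsets∣ v s))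
                           (¬regular l) (¬regular (suc l))

adesign⇒t-adesign-or-design : ∀ {t v k l} {B : List (Subset v)} → IsADesign (suc t) v k l B → 1 ≤ t →
  v ∸ t < 2 * (k ∸ t) →
    IsADesign t v k (ceilDiv (l * (v ∸ t)) (k ∸ t)) B
  ⊎ IsDesign t v k (ceilDiv (l * (v ∸ t)) (k ∸ t)) B
  ⊎ IsDesign t v k (suc (ceilDiv (l * (v ∸ t)) (k ∸ t))) B
adesign⇒t-adesign-or-design {t} {v} {k} {l} {B} (_ , 1+t<k , k<v , 0<l , uniform , almost , _) 0<t v∸t<2[k∸t] =
  by-cases (regular-or-counterexample t μ B) (regular-or-counterexample t (suc μ) B)
  where
  μ : ℕ
  μ = ceilDiv (l * (v ∸ t)) (k ∸ t)
  t<k : t < k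
  t<k = <-trans (n<1+n t) 1+t<k
  0<k∸t : 0 < k ∸ t
  0<k∸t = m<n⇒0<n∸m t<k
  almost-regular : AlmostRegular t μ B
  almost-regular Y ∣Y∣≡t with extension-bounds uniform almost Y ∣Y∣≡t
  ... | lower , upper = ceilDiv-or-suc (r B Y) 0<k∸t lower upper v∸t<2[k∸t]
  by-cases : Regular t μ B ⊎ ∃ (λ Y → ∣ Y ∣ ≡ t × r B Y ≢ μ) →
             Regular t (suc μ) B ⊎ ∃ (λ Y → ∣ Y ∣ ≡ t × r B Y ≢ suc μ) →
             IsADesign t v k μ B ⊎ IsDesign t v k μ B ⊎ IsDesign t v k (suc μ) B
  by-cases (inj₁ regular) _             = inj₂ (inj₁ (0<t , t<k , k<v , uniform , regular))
  by-cases (inj₂ _)       (inj₁ regular) = inj₂ (inj₂ (0<t , t<k , k<v , uniform , regular))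
  by-cases (inj₂ (Y₁ , ∣Y₁∣≡t , r₁≢μ)) (inj₂ (Y₂ , ∣Y₂∣≡t , r₂≢1+μ)) =
    inj₁ (0<t , t<k , k<v , 0<μ , uniform , almost-regular , ¬design)
    where
    0<μ : 0 < μ
    0<μ = ceilDiv-pos 0<k∸t (*-mono-< 0<l (m<n⇒0<n∸m (<-trans t<k k<v)))
    -- A t-design would give r_{Y₁} = r_{Y₂}, yet r_{Y₁} ≠ μ forces r_{Y₁} = μ + 1 ≠ r_{Y₂}.
    ¬design : ¬ ∃ (λ λ′ → IsDesign t v k λ′ B)
    ¬design (_ , _ , _ , _ , _ , regular) with almost-regular Y₁ ∣Y₁∣≡t
    ... | inj₁ r₁≡μ   = r₁≢μ r₁≡μ
    ... | inj₂ r₁≡1+μ = r₂≢1+μ (trans (regular Y₂ ∣Y₂∣≡t) (trans (sym (regular Y₁ ∣Y₁∣≡t)) r₁≡1+μ))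

adesign∧design⇒floor : ∀ {t v k l l′} {B : List (Subset v)} → IsADesign (suc t) v k l B →
  IsDesign t v k l′ B → l ≡ floorDiv (l′ * (k ∸ t)) (v ∸ t)
adesign∧design⇒floor {t} {v} {k} {l} {l′} {B} (_ , 1+t<k , k<v , _ , uniform , almost , ¬design) (_ , _ , _ , _ , regular) =
  sym (floorDiv-unique l (m<n⇒0<n∸m t<v) lower (≤∧≢⇒< upper upper-not-attained))
  where
  t<v : t < v
  t<v = <-trans (<-trans (n<1+n t) 1+t<k) k<v
  Y₀ : Subset v
  Y₀ = proj₁ (subset-of-size (<⇒≤ t<v))
  ∣Y₀∣≡t : ∣ Y₀ ∣ ≡ t
  ∣Y₀∣≡t = proj₂ (subset-of-size (<⇒≤ t<v))
  bounds : l * (v ∸ t) ≤ r B Y₀ * (k ∸ t) × r B Y₀ * (k ∸ t) ≤ suc l * (v ∸ t)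
  bounds = extension-bounds uniform almost Y₀ ∣Y₀∣≡t
  lower : l * (v ∸ t) ≤ l′ * (k ∸ t)
  lower = subst (λ n → l * (v ∸ t) ≤ n * (k ∸ t)) (regular Y₀ ∣Y₀∣≡t) (proj₁ bounds)
  upper : l′ * (k ∸ t) ≤ suc l * (v ∸ t)
  upper = subst (λ n → n * (k ∸ t) ≤ suc l * (v ∸ t)) (regular Y₀ ∣Y₀∣≡t) (proj₂ bounds)
  upper-not-attained : l′ * (k ∸ t) ≢ suc l * (v ∸ t)
  upper-not-attained attained = ¬design (suc l , s≤s z≤n , 1+t<k , k<v , uniform ,
    upper-bound-attained⇒regular uniform (λ Z e → proj₂ (≡⊎≡suc⇒≤×≤ (almost Z e)))
      (λ Y e → trans (cong (_* (k ∸ t)) (regular Y e)) attained))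

lemma2 : ∀ {v k t l : ℕ} (B : List (Subset v)) → Unique B →
    IsADesign (suc t) v k l B → 1 ≤ t →
    (∀ (Y : Subset v) → ∣ Y ∣ ≡ t →
        l * (v ∸ t) ≤ r B Y * (k ∸ t) × r B Y * (k ∸ t) ≤ suc l * (v ∸ t))
    × (v ∸ t < 2 * (k ∸ t) →
        IsADesign t v k (ceilDiv (l * (v ∸ t)) (k ∸ t)) B
        ⊎ IsDesign t v k (ceilDiv (l * (v ∸ t)) (k ∸ t)) B
        ⊎ IsDesign t v k (suc (ceilDiv (l * (v ∸ t)) (k ∸ t))) B)
    × (∀ (l′ : ℕ) → IsDesign t v k l′ B →
        l ≡ floorDiv (l′ * (k ∸ t)) (v ∸ t)
        × l * (v C suc t) < length B * (k C suc t)
        × length B * (k C suc t) < suc l * (v C suc t))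
lemma2 B _ adesign@(_ , _ , _ , _ , uniform , almost , _) 0<t =
    extension-bounds uniform almost
  , adesign⇒t-adesign-or-design adesign 0<t
  , λ l′ design → adesign∧design⇒floor adesign design , adesign-block-bounds adesign
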